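{- Let $n\ge3$ and let $\mathbf w=[w_1,w_2,\dots]$ be an infinite sequence in $\{1,\dots,n\}$ with $w_{t+1}\ne w_t$ for all $t$, in which every index occurs infinitely often. Let ${}_0x\in\mathbb{Z}_{>0}^n$ and ${}_0y\in\mathbb{Z}_{\ge0}^n$, and define ${}_{t+1}x=\mathcal M_{w_{t+1};0}({}_tx)$ and ${}_{t+1}y=\mathcal M_{w_{t+1};0}({}_ty)$ for $t\ge0$. Let ${}_tl_j={}_ty_j/{}_tx_j$ and, for $t\ge1$, $\mathfrak l_t={}_tl_{w_t}$. Then the sequence $(\mathfrak l_t)_{t\ge1}$ is bounded above.
   Context: For $k\ge 0$ and $i\in\{1,\dots,n\}$, $\mathcal M_{i;k}(z_1,\dots,z_n)$ is obtained from $(z_1,\dots,z_n)$ by replacing $z_i$ with $z_1+\cdots+\widehat{z_i}+\cdots+z_n+k$ (omitting $z_i$ from the sum) and keeping the other coordinates. -}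

module Defs where

open import Data.Nat using (ℕ; zero; suc; _+_)
open import Data.Fin using (Fin; _≟_)
open import Data.List using (List; map; filter; allFin)
open import Data.Nat.ListAction using (sum)
open import Relation.Nullary using (yes; no; ¬?)

sumExcept : ∀ {n} → Fin n → (Fin n → ℕ) → ℕ
sumExcept {n} i z = sum (map z (filter (λ j → ¬? (j ≟ i)) (allFin n)))

mutation : ∀ {n} → Fin n → ℕ → (Fin n → ℕ) → (Fin n → ℕ)
mutation i k z j with j ≟ i
... | yes _ = sumExcept i z + k
... | no  _ = z j

-- w : ℕ → Fin n with  w t  standing for  w_{t+1}  (paper's sequence is 1-indexed).
-- orbit w z₀ t = ₜz, where ₜ₊₁z = 𝓜_{w_{t+1};0}(ₜz).
orbit : ∀ {n} → (ℕ → Fin n) → (Fin n → ℕ) → ℕ → (Fin n → ℕ)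
orbit w z₀ zero    = z₀
orbit w z₀ (suc t) = mutation (w t) 0 (orbit w z₀ t)

{-# OPTIONS --safe #-}
-- Take K = ∑ⱼ ₀yⱼ. Since ₀x > 0, every coordinate satisfies ₀yⱼ ≤ K · ₀xⱼ. A mutation
-- replaces the same coordinate of x and y by the sum of the other coordinates, and
-- inequalities y ≤ K · x add up, so ₜy ≤ K · ₜx holds for every t. Hence every ratio
-- ₜyⱼ / ₜxⱼ, in particular 𝔩ₜ, is at most K. The bound needs none of the hypotheses on
-- n and w.
module Submission where

open import Defs
open import Data.Nat using (ℕ; suc; _≤_; _<_; NonZero)
open import Data.Fin using (Fin)
open import Data.Integer using (+_)
open import Data.Rational using (ℚ; _/_) renaming (_≤_ to _≤ℚ_)
open import Data.Product using (Σ; ∃; _×_)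
open import Relation.Binary.PropositionalEquality using (_≡_; _≢_)

open import Data.Nat using (zero; _+_; _*_; z≤n; >-nonZero)
open import Data.Nat.Properties
  using (≤-trans; ≤-reflexive; m≤m+n; m≤n+m; m≤m*n; +-mono-≤; *-distribˡ-+; *-zeroʳ; *-identityʳ)
open import Data.Fin using (_≟_)
open import Data.Integer using (+≤+) renaming (_≤_ to _≤ℤ_)
open import Data.Integer.Properties using (pos-*)
open import Data.Rational using (toℚᵘ)
open import Data.Rational.Properties using (toℚᵘ-cancel-≤; toℚᵘ-fromℚᵘ)
open import Data.Rational.Unnormalised using (mkℚᵘ; *≤*)
open import Data.Rational.Unnormalised.Properties using (module ≤-Reasoning)
open import Data.List using (List; []; _∷_; map; filter; allFin)
open import Data.List.Membership.Propositional using (_∈_)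
open import Data.List.Membership.Propositional.Properties using (∈-allFin)
open import Data.List.Relation.Unary.Any using (here; there)
open import Data.Nat.ListAction using (sum)
open import Relation.Nullary using (yes; no; ¬?)
open import Relation.Binary.PropositionalEquality using (refl; sym; subst₂)
open import Data.Product using (_,_)

_≤[_]*_ : ∀ {n} → (Fin n → ℕ) → ℕ → (Fin n → ℕ) → Set
y ≤[ K ]* x = ∀ j → y j ≤ K * x j

sum-map-≤-* : ∀ {A : Set} K (x y : A → ℕ) → (∀ a → y a ≤ K * x a) →
  ∀ (as : List A) → sum (map y as) ≤ K * sum (map x as)
sum-map-≤-* K x y y≤Kx [] = ≤-reflexive (sym (*-zeroʳ K))
sum-map-≤-* K x y y≤Kx (a ∷ as) = ≤-trans
  (+-mono-≤ (y≤Kx a) (sum-map-≤-* K x y y≤Kx as))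
  (≤-reflexive (sym (*-distribˡ-+ K (x a) (sum (map x as)))))

∈⇒≤-sum-map : ∀ {A : Set} (f : A → ℕ) {a} {as : List A} → a ∈ as → f a ≤ sum (map f as)
∈⇒≤-sum-map f (here refl) = m≤m+n _ _
∈⇒≤-sum-map f (there a∈as) = ≤-trans (∈⇒≤-sum-map f a∈as) (m≤n+m _ _)

sumExcept-≤-* : ∀ {n} (i : Fin n) K {x y} → y ≤[ K ]* x →
  sumExcept i y ≤ K * sumExcept i x
sumExcept-≤-* {n} i K {x} {y} y≤Kx = sum-map-≤-* K x y y≤Kx (filter (λ j → ¬? (j ≟ i)) (allFin n))

mutation-≤-* : ∀ {n} (i : Fin n) K {k l x y} → k ≤ K * l → y ≤[ K ]* x →
  mutation i k y ≤[ K ]* mutation i l x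
mutation-≤-* i K {l = l} {x} k≤Kl y≤Kx j with j ≟ i
... | yes _ = ≤-trans (+-mono-≤ (sumExcept-≤-* i K y≤Kx) k≤Kl)
                      (≤-reflexive (sym (*-distribˡ-+ K (sumExcept i x) l)))
... | no  _ = y≤Kx j

orbit-≤-* : ∀ {n} (w : ℕ → Fin n) K {x₀ y₀} → y₀ ≤[ K ]* x₀ →
  ∀ t → orbit w y₀ t ≤[ K ]* orbit w x₀ t
orbit-≤-* w K y₀≤Kx₀ zero = y₀≤Kx₀
orbit-≤-* w K y₀≤Kx₀ (suc t) = mutation-≤-* (w t) K z≤n (orbit-≤-* w K y₀≤Kx₀ t)

≤[sum]*-of-positive : ∀ {n} (x y : Fin n → ℕ) → (∀ j → 0 < x j) →
  y ≤[ sum (map y (allFin n)) ]* x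
≤[sum]*-of-positive x y x>0 j = ≤-trans (∈⇒≤-sum-map y (∈-allFin j))
  (m≤m*n _ (x j) {{>-nonZero (x>0 j)}})

/-≤-integer : ∀ a b K .{{_ : NonZero b}} → a ≤ K * b → (+ a) / b ≤ℚ (+ K) / 1
/-≤-integer a b@(suc b-1) K a≤Kb = toℚᵘ-cancel-≤ (begin
  toℚᵘ ((+ a) / b)   ≃⟨ toℚᵘ-fromℚᵘ (mkℚᵘ (+ a) b-1) ⟩
  mkℚᵘ (+ a) b-1     ≤⟨ *≤* (subst₂ _≤ℤ_ (pos-* a 1) (pos-* K b)
                              (+≤+ (≤-trans (≤-reflexive (*-identityʳ a)) a≤Kb))) ⟩
  mkℚᵘ (+ K) 0       ≃⟨ toℚᵘ-fromℚᵘ (mkℚᵘ (+ K) 0) ⟨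
  toℚᵘ ((+ K) / 1)   ∎)
  where open ≤-Reasoning

proposition3p4 : (n : ℕ) → 3 ≤ n → (w : ℕ → Fin n) →
    (∀ t → w (suc t) ≢ w t) →
    (∀ (i : Fin n) (N : ℕ) → ∃ λ t → N ≤ t × w t ≡ i) →
    (x₀ y₀ : Fin n → ℕ) → (∀ j → 0 < x₀ j) →
    ∃ λ (B : ℚ) → ∀ (s : ℕ) →
    .{{_ : NonZero (orbit w x₀ (suc s) (w s))}} →
    ((+ orbit w y₀ (suc s) (w s)) / orbit w x₀ (suc s) (w s)) ≤ℚ B
proposition3p4 n _ w _ _ x₀ y₀ x₀>0 = (+ K) / 1 , λ s →
  /-≤-integer _ _ K (orbit-≤-* w K (≤[sum]*-of-positive x₀ y₀ x₀>0) (suc s) (w s))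
  where
  K : ℕ
  K = sum (map y₀ (allFin n))
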